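{- Let $n\ge2$ and let $A=(a_{ij})$ be an antisymmetric $n\times n$ complex matrix. Let $A'$ be the matrix obtained from $A$ by replacing the entries $a_{12}$ and $a_{21}$ by $0$. Let $B$ be the $n\times n$ block matrix whose upper-left $2\times2$ block is $\begin{pmatrix}1&1\\0&1\end{pmatrix}$ and whose complementary diagonal block is the $(n-2)\times(n-2)$ identity matrix (off-diagonal blocks zero), and let $\widetilde A=B^{t}AB$ and $\widetilde A'=B^{t}A'B$. Then, writing $\chi_M(u)=\det(uI-M)$, $$\chi_A-\chi_{A'}=\chi_{\widetilde A}-\chi_{\widetilde A'}.$$
   Context: $B^t$ denotes the transpose of $B$. (One checks that $\widetilde A'$ also equals the result of replacing the $(1,2)$ and $(2,1)$ entries of $\widetilde A$ by $0$.) -}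

module Defs where

open import Level using (Level)
open import Data.Nat using (ℕ; zero; suc)
open import Data.Fin using (Fin; zero; suc; punchIn; _≟_)
open import Data.Bool using (if_then_else_)
open import Relation.Nullary.Decidable using (⌊_⌋)
open import Algebra.Bundles using (CommutativeRing)

module _ {c ℓ : Level} (R : CommutativeRing c ℓ) where
  open CommutativeRing R using (Carrier; _≈_; _+_; _*_; _-_; -_; 0#; 1#)

  Matrix : ℕ → Set c
  Matrix n = Fin n → Fin n → Carrier

  sumF : {n : ℕ} → (Fin n → Carrier) → Carrier
  sumF {zero}  f = 0#
  sumF {suc n} f = f zero + sumF (λ i → f (suc i))

  altSumF : {n : ℕ} → (Fin n → Carrier) → Carrier
  altSumF {zero}  f = 0#
  altSumF {suc n} f = f zero - altSumF (λ i → f (suc i))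

  det : {n : ℕ} → Matrix n → Carrier
  det {zero}  M = 1#
  det {suc n} M = altSumF (λ j → M zero j * det (λ i k → M (suc i) (punchIn j k)))

  idM : {n : ℕ} → Matrix n
  idM i j = if ⌊ i ≟ j ⌋ then 1# else 0#

  transpose : {n : ℕ} → Matrix n → Matrix n
  transpose M i j = M j i

  _*M_ : {n : ℕ} → Matrix n → Matrix n → Matrix n
  (M *M N) i j = sumF (λ k → M i k * N k j)

  charPoly : {n : ℕ} → Matrix n → Carrier → Carrier
  charPoly M u = det (λ i j → u * idM i j - M i j)

  IsAntisymmetric : {n : ℕ} → Matrix n → Set ℓ
  IsAntisymmetric A = ∀ i j → A j i ≈ - A i j

  zero12 : {m : ℕ} → Matrix (suc (suc m)) → Matrix (suc (suc m))
  zero12 A zero (suc zero) = 0#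
  zero12 A (suc zero) zero = 0#
  zero12 A i j = A i j

  Bmat : {m : ℕ} → Matrix (suc (suc m))
  Bmat zero (suc zero) = 1#
  Bmat i j = idM i j

  conjB : {m : ℕ} → Matrix (suc (suc m)) → Matrix (suc (suc m))
  conjB M = (transpose Bmat *M M) *M Bmat

{-# OPTIONS --safe #-}
-- Expanding det M along its first two rows shows that det M is affine in each
-- of the corner entries p = M₀₁ and q = M₁₀:
--   det M = K + p (V − q P) + q X,
-- where K, P, V, X do not involve p and q.  Hence χ_A − χ_{A'} only sees the
-- coefficients P, V, X of uI − A.  Conjugating by B adds row 0 to row 1 and
-- column 0 to column 1; off the top-left 2×2 block uI − BᵗAB is the same shear
-- of uI − A, which keeps P and shifts both V and X by one and the same
-- quantity Y.  The two differences of characteristic polynomials then differ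
-- by (a₁₂ + a₂₁)(a₁₁ P + Y), which vanishes for antisymmetric A.
module Submission where

open import Defs
open import Level using (Level)
open import Data.Nat using (ℕ; zero; suc)
open import Algebra.Bundles using (CommutativeRing)
open import Data.Fin using (Fin; zero; suc; punchIn; _≟_)
open import Data.Integer.Base as ℤ using (ℤ; +_; -[1+_])
import Data.Integer.Properties as ℤ
open import Data.Maybe.Base using (Maybe; map)
open import Relation.Nullary using (yes; no)
open import Relation.Binary.Consequences using (dec⇒weaklyDec)
import Relation.Binary.PropositionalEquality as ≡
open import Algebra.Solver.Ring.AlmostCommutativeRing
  using (_-Raw-AlmostCommutative⟶_; fromCommutativeRing)

-- Integer coefficients let the ring solver cancel terms over an arbitrary commutative ring.
module IntegerCoefficients {c ℓ : Level} (R : CommutativeRing c ℓ) where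
  open CommutativeRing R hiding (zero)
  open import Algebra.Properties.Ring ring
    using (-0#≈0#; -‿involutive; -‿+-comm; -‿distribˡ-*; -‿distribʳ-*)
  open import Algebra.Properties.CommutativeSemigroup +-commutativeSemigroup
    using (interchange)
  open import Algebra.Properties.Semiring.Mult semiring using (_×_; ×-homo-+; ×1-homo-*)
  open import Relation.Binary.Reasoning.Setoid setoid

  ι : ℤ → Carrier
  ι (+ n)    = n × 1#
  ι -[1+ n ] = - (suc n × 1#)

  ι-neg : ∀ i → ι (ℤ.- i) ≈ - ι i
  ι-neg (+ zero)  = sym -0#≈0#
  ι-neg (+ suc n) = refl
  ι-neg -[1+ n ]  = sym (-‿involutive _)

  ι-⊖ : ∀ m n → ι (m ℤ.⊖ n) ≈ m × 1# - n × 1#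
  ι-⊖ m       zero    = sym (trans (+-congˡ -0#≈0#) (+-identityʳ _))
  ι-⊖ zero    (suc n) = sym (+-identityˡ _)
  ι-⊖ (suc m) (suc n) = begin
    ι (suc m ℤ.⊖ suc n)         ≡⟨ ≡.cong ι (ℤ.[1+m]⊖[1+n]≡m⊖n m n) ⟩
    ι (m ℤ.⊖ n)                 ≈⟨ ι-⊖ m n ⟩
    x - y                       ≈⟨ +-identityˡ _ ⟨
    0# + (x - y)                ≈⟨ +-congʳ (-‿inverseʳ 1#) ⟨
    (1# - 1#) + (x - y)         ≈⟨ interchange _ _ _ _ ⟩
    (1# + x) + (- 1# + - y)     ≈⟨ +-congˡ (-‿+-comm 1# y) ⟩
    (1# + x) - (1# + y)         ∎
    where
    x y : Carrier
    x = m × 1#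
    y = n × 1#

  ι-+ : ∀ i j → ι (i ℤ.+ j) ≈ ι i + ι j
  ι-+ (+ m)    (+ n)    = ×-homo-+ 1# m n
  ι-+ (+ m)    -[1+ n ] = ι-⊖ m (suc n)
  ι-+ -[1+ m ] (+ n)    = trans (ι-⊖ n (suc m)) (+-comm _ _)
  ι-+ -[1+ m ] -[1+ n ] = begin
    ι (-[1+ m ] ℤ.+ -[1+ n ])          ≡⟨ ≡.cong ι (ℤ.neg-distrib-+ (+ suc m) (+ suc n)) ⟨
    ι (ℤ.- (+ suc m ℤ.+ + suc n))      ≈⟨ ι-neg (+ suc m ℤ.+ + suc n) ⟩
    - ι (+ suc m ℤ.+ + suc n)          ≈⟨ -‿cong (ι-+ (+ suc m) (+ suc n)) ⟩
    - (ι (+ suc m) + ι (+ suc n))      ≈⟨ -‿+-comm _ _ ⟨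
    ι -[1+ m ] + ι -[1+ n ]            ∎

  ι-*-pos : ∀ m n → ι (+ m ℤ.* + n) ≈ ι (+ m) * ι (+ n)
  ι-*-pos m n = trans (reflexive (≡.cong ι (≡.sym (ℤ.pos-* m n)))) (×1-homo-* m n)

  ι-* : ∀ i j → ι (i ℤ.* j) ≈ ι i * ι j
  ι-* (+ m)    (+ n)    = ι-*-pos m n
  ι-* (+ m)    -[1+ n ] = begin
    ι (+ m ℤ.* -[1+ n ])           ≡⟨ ≡.cong ι (ℤ.neg-distribʳ-* (+ m) (+ suc n)) ⟨
    ι (ℤ.- (+ m ℤ.* + suc n))      ≈⟨ ι-neg (+ m ℤ.* + suc n) ⟩
    - ι (+ m ℤ.* + suc n)          ≈⟨ -‿cong (ι-*-pos m (suc n)) ⟩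
    - (ι (+ m) * ι (+ suc n))      ≈⟨ -‿distribʳ-* _ _ ⟩
    ι (+ m) * ι -[1+ n ]           ∎
  ι-* -[1+ m ] (+ n)    = begin
    ι (-[1+ m ] ℤ.* + n)           ≡⟨ ≡.cong ι (ℤ.neg-distribˡ-* (+ suc m) (+ n)) ⟨
    ι (ℤ.- (+ suc m ℤ.* + n))      ≈⟨ ι-neg (+ suc m ℤ.* + n) ⟩
    - ι (+ suc m ℤ.* + n)          ≈⟨ -‿cong (ι-*-pos (suc m) n) ⟩
    - (ι (+ suc m) * ι (+ n))      ≈⟨ -‿distribˡ-* _ _ ⟩
    ι -[1+ m ] * ι (+ n)           ∎
  ι-* -[1+ m ] -[1+ n ] = begin
    ι (+ suc m ℤ.* + suc n)        ≈⟨ ι-*-pos (suc m) (suc n) ⟩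
    x * y                          ≈⟨ -‿involutive _ ⟨
    - - (x * y)                    ≈⟨ -‿cong (-‿distribʳ-* x y) ⟩
    - (x * - y)                    ≈⟨ -‿distribˡ-* x (- y) ⟩
    - x * - y                      ∎
    where
    x y : Carrier
    x = ι (+ suc m)
    y = ι (+ suc n)

  ι-morphism : ℤ.+-*-rawRing -Raw-AlmostCommutative⟶ fromCommutativeRing R
  ι-morphism = record
    { ⟦_⟧    = ι
    ; +-homo = ι-+
    ; *-homo = ι-*
    ; -‿homo = ι-neg
    ; 0-homo = refl
    ; 1-homo = +-identityʳ 1#
    }

  ι-≟ : ∀ i j → Maybe (ι i ≈ ι j)
  ι-≟ i j = map (λ { ≡.refl → refl }) (dec⇒weaklyDec ℤ._≟_ i j)

  open import Algebra.Solver.Ring ℤ.+-*-rawRing (fromCommutativeRing R) ι-morphism ι-≟ public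

module CornerExpansion {c ℓ : Level} (R : CommutativeRing c ℓ) where
  open CommutativeRing R hiding (zero)
  open import Relation.Binary.Reasoning.Setoid setoid
  open IntegerCoefficients R using (Polynomial; solve; _:=_; _:+_; _:*_; _:-_; con)

  -‿cong₂ : ∀ {x x′ y y′} → x ≈ x′ → y ≈ y′ → x - y ≈ x′ - y′
  -‿cong₂ x≈x′ y≈y′ = +-cong x≈x′ (-‿cong y≈y′)

  sumF-cong : ∀ {n} {f g : Fin n → Carrier} → (∀ i → f i ≈ g i) → sumF R f ≈ sumF R g
  sumF-cong {zero}  f≈g = refl
  sumF-cong {suc n} f≈g = +-cong (f≈g zero) (sumF-cong (λ i → f≈g (suc i)))

  sumF-zero : ∀ {n} (f : Fin n → Carrier) → (∀ i → f i ≈ 0#) → sumF R f ≈ 0#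
  sumF-zero {zero}  f f≈0 = refl
  sumF-zero {suc n} f f≈0 =
    trans (+-cong (f≈0 zero) (sumF-zero (λ i → f (suc i)) (λ i → f≈0 (suc i))))
      (+-identityʳ 0#)

  idM-suc : ∀ {n} (i j : Fin n) → idM R (suc i) (suc j) ≈ idM R i j
  idM-suc i j with i ≟ j
  ... | yes _ = refl
  ... | no  _ = refl

  sumF-idM : ∀ {n} (i : Fin n) (f : Fin n → Carrier) →
    sumF R (λ l → idM R l i * f l) ≈ f i
  sumF-idM zero    f = trans (+-cong (*-identityˡ _) tail) (+-identityʳ _)
    where
    tail : sumF R (λ l → idM R (suc l) zero * f (suc l)) ≈ 0#
    tail = sumF-zero (λ l → idM R (suc l) zero * f (suc l)) (λ l → zeroˡ _)
  sumF-idM (suc i) f = trans (+-cong (zeroˡ _) tail) (+-identityˡ _)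
    where
    tail : sumF R (λ l → idM R (suc l) (suc i) * f (suc l)) ≈ f (suc i)
    tail = trans (sumF-cong (λ l → *-congʳ (idM-suc l i))) (sumF-idM i (λ l → f (suc l)))

  altSumF-cong : ∀ {n} {f g : Fin n → Carrier} → (∀ i → f i ≈ g i) →
    altSumF R f ≈ altSumF R g
  altSumF-cong {zero}  f≈g = refl
  altSumF-cong {suc n} f≈g = -‿cong₂ (f≈g zero) (altSumF-cong (λ i → f≈g (suc i)))

  altSumF-+ : ∀ {n} (f g : Fin n → Carrier) →
    altSumF R (λ i → f i + g i) ≈ altSumF R f + altSumF R g
  altSumF-+ {zero}  f g = sym (+-identityʳ 0#)
  altSumF-+ {suc n} f g = begin
    (f zero + g zero) - altSumF R (λ i → f (suc i) + g (suc i))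
      ≈⟨ -‿cong₂ refl (altSumF-+ (λ i → f (suc i)) (λ i → g (suc i))) ⟩
    (f zero + g zero) - (altSumF R (λ i → f (suc i)) + altSumF R (λ i → g (suc i)))
      ≈⟨ solve 4 (λ a b s t → (a :+ b) :- (s :+ t) := (a :- s) :+ (b :- t)) refl _ _ _ _ ⟩
    (f zero - altSumF R (λ i → f (suc i))) + (g zero - altSumF R (λ i → g (suc i))) ∎

  altSumF-linear : ∀ {n} (x d t : Fin n → Carrier) (q : Carrier) →
    altSumF R (λ j → x j * (q * d j - t j))
      ≈ q * altSumF R (λ j → x j * d j) - altSumF R (λ j → x j * t j)
  altSumF-linear {zero}  x d t q =
    solve 1 (λ q → con (+ 0) := q :* con (+ 0) :- con (+ 0)) refl q
  altSumF-linear {suc n} x d t q =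
    trans (-‿cong₂ refl (altSumF-linear (λ j → x (suc j)) (λ j → d (suc j)) (λ j → t (suc j)) q))
      (solve 6 (λ x₀ d₀ t₀ q s s′ → x₀ :* (q :* d₀ :- t₀) :- (q :* s :- s′)
                                   := q :* (x₀ :* d₀ :- s) :- (x₀ :* t₀ :- s′))
             refl (x zero) (d zero) (t zero) q _ _)

  det-cong : ∀ {n} {M N : Matrix R n} → (∀ i j → M i j ≈ N i j) → det R M ≈ det R N
  det-cong {zero}  M≈N = refl
  det-cong {suc n} M≈N =
    altSumF-cong (λ j → *-cong (M≈N zero j) (det-cong (λ i k → M≈N (suc i) (punchIn j k))))

  minor₀ : ∀ {n} → Matrix R (suc n) → Fin (suc n) → Matrix R n
  minor₀ M j i k = M (suc i) (punchIn j k)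

  mutual
    det-linear₀ : ∀ {n} (M M₁ M₂ : Matrix R (suc n)) →
      (∀ i → M i zero ≈ M₁ i zero + M₂ i zero) →
      (∀ i j → M i (suc j) ≈ M₁ i (suc j)) → (∀ i j → M i (suc j) ≈ M₂ i (suc j)) →
      det R M ≈ det R M₁ + det R M₂
    det-linear₀ M M₁ M₂ h₀ h₁ h₂ =
      trans (altSumF-cong (expansionTerm-linear₀ M M₁ M₂ h₀ h₁ h₂))
        (altSumF-+ (λ j → M₁ zero j * det R (minor₀ M₁ j))
                   (λ j → M₂ zero j * det R (minor₀ M₂ j)))

    expansionTerm-linear₀ : ∀ {n} (M M₁ M₂ : Matrix R (suc n)) →
      (∀ i → M i zero ≈ M₁ i zero + M₂ i zero) →
      (∀ i j → M i (suc j) ≈ M₁ i (suc j)) → (∀ i j → M i (suc j) ≈ M₂ i (suc j)) →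
      ∀ j → M zero j * det R (minor₀ M j)
              ≈ M₁ zero j * det R (minor₀ M₁ j) + M₂ zero j * det R (minor₀ M₂ j)
    expansionTerm-linear₀ M M₁ M₂ h₀ h₁ h₂ zero =
      trans (*-congʳ (h₀ zero))
        (trans (distribʳ _ _ _)
          (+-cong (*-congˡ (det-cong (λ i k → h₁ (suc i) k)))
                  (*-congˡ (det-cong (λ i k → h₂ (suc i) k)))))
    expansionTerm-linear₀ {suc n} M M₁ M₂ h₀ h₁ h₂ (suc j) =
      trans (*-congˡ (det-linear₀ (minor₀ M (suc j)) (minor₀ M₁ (suc j)) (minor₀ M₂ (suc j))
                        (λ i → h₀ (suc i))
                        (λ i k → h₁ (suc i) (punchIn j k))
                        (λ i k → h₂ (suc i) (punchIn j k))))
        (trans (distribˡ _ _ _) (+-cong (*-congʳ (h₁ zero j)) (*-congʳ (h₂ zero j))))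
    expansionTerm-linear₀ {zero} _ _ _ _ _ _ (suc ())

  charMat : ∀ {n} → Matrix R n → Carrier → Matrix R n
  charMat A u i j = u * idM R i j - A i j

  module _ {m : ℕ} where

    shear : (Fin (suc (suc m)) → Carrier) → Fin (suc (suc m)) → Carrier
    shear v (suc zero) = v zero + v (suc zero)
    shear v i          = v i

    shear-cong : ∀ {v w} → (∀ i → v i ≈ w i) → ∀ i → shear v i ≈ shear w i
    shear-cong v≈w zero          = v≈w zero
    shear-cong v≈w (suc zero)    = +-cong (v≈w zero) (v≈w (suc zero))
    shear-cong v≈w (suc (suc i)) = v≈w (suc (suc i))

    sumF-Bmat : ∀ (v : Fin (suc (suc m)) → Carrier) i →
      sumF R (λ l → Bmat R l i * v l) ≈ shear v i
    sumF-Bmat v zero          = sumF-idM zero v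
    sumF-Bmat v (suc zero)    = +-cong (*-identityˡ _)
      (trans (sumF-cong (λ l → *-congʳ {v (suc l)} (idM-suc l zero)))
             (sumF-idM zero (λ l → v (suc l))))
    sumF-Bmat v (suc (suc i)) = sumF-idM (suc (suc i)) v

    shearConj : Matrix R (suc (suc m)) → Matrix R (suc (suc m))
    shearConj M i j = shear (λ k → shear (λ l → M l k) i) j

    conjB-shearConj : ∀ (M : Matrix R (suc (suc m))) i j → conjB R M i j ≈ shearConj M i j
    conjB-shearConj M i j = begin
      sumF R (λ k → BᵗM i k * Bmat R k j)  ≈⟨ sumF-cong (λ k → *-comm (BᵗM i k) (Bmat R k j)) ⟩
      sumF R (λ k → Bmat R k j * BᵗM i k)  ≈⟨ sumF-Bmat _ j ⟩
      shear (λ k → BᵗM i k) j              ≈⟨ shear-cong (λ k → sumF-Bmat (λ l → M l k) i) j ⟩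
      shearConj M i j                      ∎
      where
      BᵗM : Matrix R (suc (suc m))
      BᵗM = _*M_ R (transpose R (Bmat R)) M

    withCorner : Matrix R (suc (suc m)) → Carrier → Carrier → Matrix R (suc (suc m))
    withCorner M p q zero (suc zero) = p
    withCorner M p q (suc zero) zero = q
    withCorner M p q i j             = M i j

    minor₀₁ : Matrix R (suc (suc m)) → Fin (suc (suc m)) → Fin (suc m) → Carrier
    minor₀₁ M j k = det R (λ i l → M (suc (suc i)) (punchIn j (punchIn k l)))

    coeff₀₁₁₀ coeff₀₁ coeff₁₀ shearShift constTerm : Matrix R (suc (suc m)) → Carrier
    coeff₀₁₁₀ M = minor₀₁ M (suc zero) zero
    coeff₀₁ M = altSumF R (λ k → M (suc zero) (suc (suc k)) * minor₀₁ M (suc zero) (suc k))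
    coeff₁₀ M = altSumF R (λ k → M zero (suc (suc k)) * minor₀₁ M (suc (suc k)) zero)
    shearShift M = altSumF R (λ k → M zero (suc (suc k)) * minor₀₁ M (suc zero) (suc k))
    constTerm M = M zero zero * det R (minor₀ M zero) - altSumF R (λ j →
      M zero (suc (suc j)) * altSumF R (λ k →
        M (suc zero) (punchIn (suc (suc j)) (suc k)) * minor₀₁ M (suc (suc j)) (suc k)))

  corner : (P V X p q : Carrier) → Carrier
  corner P V X p q = p * (V - q * P) + q * X

  module _ {m : ℕ} where

    cornerOf : Matrix R (suc (suc m)) → Carrier → Carrier → Carrier
    cornerOf M = corner (coeff₀₁₁₀ M) (coeff₀₁ M) (coeff₁₀ M)

    det-expand₀₁ : ∀ (M : Matrix R (suc (suc m))) →
      det R M ≈ constTerm M + cornerOf M (M zero (suc zero)) (M (suc zero) zero)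
    det-expand₀₁ M = begin
      M zero zero * det R (minor₀ M zero) - (p * (q * P - V) - X′)
        ≈⟨ -‿cong₂ refl (-‿cong₂ refl (altSumF-linear (λ j → M zero (suc (suc j)))
             (λ j → minor₀₁ M (suc (suc j)) zero) T′ q)) ⟩
      M zero zero * det R (minor₀ M zero) - (p * (q * P - V) - (q * X - T))
        ≈⟨ solve 7 (λ y p q P V X T → y :- (p :* (q :* P :- V) :- (q :* X :- T))
                                       := (y :- T) :+ (p :* (V :- q :* P) :+ q :* X))
                   refl _ p q P V X T ⟩
      constTerm M + cornerOf M p q ∎
      where
      T′ : Fin m → Carrier
      T′ j = altSumF R (λ k →
        M (suc zero) (punchIn (suc (suc j)) (suc k)) * minor₀₁ M (suc (suc j)) (suc k))
      p q P V X T X′ : Carrier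
      p = M zero (suc zero)
      q = M (suc zero) zero
      P = coeff₀₁₁₀ M
      V = coeff₀₁ M
      X = coeff₁₀ M
      T = altSumF R (λ j → M zero (suc (suc j)) * T′ j)
      X′ = altSumF R (λ j → M zero (suc (suc j)) * det R (minor₀ M (suc (suc j))))

    constTerm-withCorner : ∀ (M : Matrix R (suc (suc m))) p q →
      constTerm (withCorner M p q) ≈ constTerm M
    constTerm-withCorner M p q = -‿cong₂ (*-congˡ (det-cong entries)) refl
      where
      entries : ∀ i k → withCorner M p q (suc i) (suc k) ≈ M (suc i) (suc k)
      entries zero    k = refl
      entries (suc i) k = refl

    det-sub-withCorner : ∀ (M : Matrix R (suc (suc m))) p q →
      det R M - det R (withCorner M p q)
        ≈ cornerOf M (M zero (suc zero)) (M (suc zero) zero) - cornerOf M p q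
    det-sub-withCorner M p q = begin
      det R M - det R (withCorner M p q)
        ≈⟨ -‿cong₂ (det-expand₀₁ M) (trans (det-expand₀₁ (withCorner M p q))
                                            (+-congʳ (constTerm-withCorner M p q))) ⟩
      (constTerm M + cornerOf M _ _) - (constTerm M + cornerOf M p q)
        ≈⟨ solve 3 (λ k x y → (k :+ x) :- (k :+ y) := x :- y) refl _ _ _ ⟩
      cornerOf M _ _ - cornerOf M p q ∎

    record ShearedOffCorner (Ñ N : Matrix R (suc (suc m))) : Set ℓ where
      field
        lower : ∀ i j → Ñ (suc (suc i)) (suc (suc j)) ≈ N (suc (suc i)) (suc (suc j))
        left₀ : ∀ i → Ñ (suc (suc i)) zero ≈ N (suc (suc i)) zero
        left₁ : ∀ i → Ñ (suc (suc i)) (suc zero)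
                        ≈ N (suc (suc i)) zero + N (suc (suc i)) (suc zero)
        top₀  : ∀ j → Ñ zero (suc (suc j)) ≈ N zero (suc (suc j))
        top₁  : ∀ j → Ñ (suc zero) (suc (suc j))
                        ≈ N zero (suc (suc j)) + N (suc zero) (suc (suc j))

  module _ {m : ℕ} {Ñ N : Matrix R (suc (suc m))} (sh : ShearedOffCorner Ñ N) where
    open ShearedOffCorner sh

    coeff₀₁₁₀-shear : coeff₀₁₁₀ Ñ ≈ coeff₀₁₁₀ N
    coeff₀₁₁₀-shear = det-cong lower

    minor₀₁-shear : ∀ k → minor₀₁ Ñ (suc zero) (suc k) ≈ minor₀₁ N (suc zero) (suc k)
    minor₀₁-shear k = det-cong entries
      where
      entries : ∀ i l → Ñ (suc (suc i)) (punchIn (suc zero) (punchIn (suc k) l))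
                      ≈ N (suc (suc i)) (punchIn (suc zero) (punchIn (suc k) l))
      entries i zero    = left₀ i
      entries i (suc l) = lower i _

    coeff₀₁-shear : coeff₀₁ Ñ ≈ shearShift N + coeff₀₁ N
    coeff₀₁-shear = trans (altSumF-cong term)
      (altSumF-+ (λ k → N zero (suc (suc k)) * minor₀₁ N (suc zero) (suc k))
                 (λ k → N (suc zero) (suc (suc k)) * minor₀₁ N (suc zero) (suc k)))
      where
      term : ∀ k → Ñ (suc zero) (suc (suc k)) * minor₀₁ Ñ (suc zero) (suc k)
                 ≈ N zero (suc (suc k)) * minor₀₁ N (suc zero) (suc k)
                   + N (suc zero) (suc (suc k)) * minor₀₁ N (suc zero) (suc k)
      term k = trans (*-cong (top₁ k) (minor₀₁-shear k)) (distribʳ _ _ _)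

  -- Column 1 of this minor of Ñ is column 0 plus column 1 of N, so it splits by linearity.
  minor₀₁-shear₁₀ : ∀ {m} {Ñ N : Matrix R (suc (suc (suc m)))} → ShearedOffCorner Ñ N →
    ∀ k → minor₀₁ Ñ (suc (suc k)) zero
            ≈ minor₀₁ N (suc (suc k)) zero + minor₀₁ N (suc zero) (suc k)
  minor₀₁-shear₁₀ {Ñ = Ñ} {N} sh k = det-linear₀
    (λ i l → Ñ (suc (suc i)) (punchIn (suc (suc k)) (punchIn zero l)))
    (λ i l → N (suc (suc i)) (punchIn (suc (suc k)) (punchIn zero l)))
    (λ i l → N (suc (suc i)) (punchIn (suc zero) (punchIn (suc k) l)))
    (λ i → trans (left₁ i) (+-comm _ _)) (λ i l → lower i _) (λ i l → lower i _)
    where open ShearedOffCorner sh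

  coeff₁₀-shear : ∀ {m} {Ñ N : Matrix R (suc (suc m))} → ShearedOffCorner Ñ N →
    coeff₁₀ Ñ ≈ coeff₁₀ N + shearShift N
  coeff₁₀-shear {zero}              sh = sym (+-identityʳ 0#)
  coeff₁₀-shear {suc m} {Ñ = Ñ} {N} sh = trans (altSumF-cong term)
    (altSumF-+ (λ k → N zero (suc (suc k)) * minor₀₁ N (suc (suc k)) zero)
               (λ k → N zero (suc (suc k)) * minor₀₁ N (suc zero) (suc k)))
    where
    open ShearedOffCorner sh
    term : ∀ k → Ñ zero (suc (suc k)) * minor₀₁ Ñ (suc (suc k)) zero
               ≈ N zero (suc (suc k)) * minor₀₁ N (suc (suc k)) zero
                 + N zero (suc (suc k)) * minor₀₁ N (suc zero) (suc k)
    term k = trans (*-cong (top₀ k) (minor₀₁-shear₁₀ sh k)) (distribˡ _ _ _)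

  shearedCornerOf : ∀ {m} → Matrix R (suc (suc m)) → Carrier → Carrier → Carrier
  shearedCornerOf N =
    corner (coeff₀₁₁₀ N) (shearShift N + coeff₀₁ N) (coeff₁₀ N + shearShift N)

  module _ {m : ℕ} {Ñ N : Matrix R (suc (suc m))} (sh : ShearedOffCorner Ñ N) where

    cornerOf-shear : ∀ p q → cornerOf Ñ p q ≈ shearedCornerOf N p q
    cornerOf-shear p q =
      +-cong (*-congˡ (-‿cong₂ (coeff₀₁-shear sh) (*-congˡ (coeff₀₁₁₀-shear sh))))
             (*-congˡ (coeff₁₀-shear sh))

  corner-shear-identity : ∀ P V X Y z α a b →
    corner P V X (z - a) (z - b) - corner P V X (z - 0#) (z - 0#)
      ≈ (corner P (Y + V) (X + Y) (z - (α + a)) (z - (α + b))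
         - corner P (Y + V) (X + Y) (z - (α + 0#)) (z - (α + 0#)))
        + (a + b) * (α * P + Y)
  corner-shear-identity = solve 8 (λ P V X Y z α a b →
      cornerₚ P V X (z :- a) (z :- b) :- cornerₚ P V X (z :- o) (z :- o)
      := (cornerₚ P (Y :+ V) (X :+ Y) (z :- (α :+ a)) (z :- (α :+ b))
          :- cornerₚ P (Y :+ V) (X :+ Y) (z :- (α :+ o)) (z :- (α :+ o)))
         :+ (a :+ b) :* (α :* P :+ Y)) refl
    where
    o : Polynomial 8
    o = con (+ 0)
    cornerₚ : (P V X p q : Polynomial 8) → Polynomial 8
    cornerₚ P V X p q = p :* (V :- q :* P) :+ q :* X

  sub-+-split : ∀ {z z′} x y → z′ ≈ 0# → z - (x + y) ≈ (z′ - x) + (z - y)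
  sub-+-split {z} {z′} x y z′≈0 = begin
    z - (x + y)         ≈⟨ solve 3 (λ z x y → z :- (x :+ y) := (con (+ 0) :- x) :+ (z :- y))
                                   refl z x y ⟩
    (0# - x) + (z - y)  ≈⟨ +-congʳ (-‿cong₂ z′≈0 refl) ⟨
    (z′ - x) + (z - y)  ∎

  module _ {m : ℕ} (A : Matrix R (suc (suc m))) (u : Carrier) where

    charMat-zero12 : ∀ i j →
      charMat (zero12 R A) u i j ≈ withCorner (charMat A u) (u * 0# - 0#) (u * 0# - 0#) i j
    charMat-zero12 zero          zero          = refl
    charMat-zero12 zero          (suc zero)    = refl
    charMat-zero12 zero          (suc (suc j)) = refl
    charMat-zero12 (suc zero)    zero          = refl
    charMat-zero12 (suc zero)    (suc j)       = refl
    charMat-zero12 (suc (suc i)) j             = refl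

    charMat-shearConj : ShearedOffCorner (charMat (shearConj A) u) (charMat A u)
    charMat-shearConj = record
      { lower = λ i j → refl
      ; left₀ = λ i → refl
      ; left₁ = λ i → sub-+-split _ _ (zeroʳ u)
      ; top₀  = λ j → refl
      ; top₁  = λ j → sub-+-split _ _ (zeroʳ u)
      }

    charPoly-sub-zero12 :
      charPoly R A u - charPoly R (zero12 R A) u
        ≈ cornerOf (charMat A u) (u * 0# - A zero (suc zero)) (u * 0# - A (suc zero) zero)
          - cornerOf (charMat A u) (u * 0# - 0#) (u * 0# - 0#)
    charPoly-sub-zero12 =
      trans (-‿cong₂ refl (det-cong charMat-zero12)) (det-sub-withCorner (charMat A u) _ _)

    module _ (a₀₁+a₁₀≈0 : A zero (suc zero) + A (suc zero) zero ≈ 0#) where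

      shearConj-zero12-diagonal :
        (A zero zero + 0#) + (0# + A (suc zero) (suc zero))
          ≈ (A zero zero + A (suc zero) zero) + (A zero (suc zero) + A (suc zero) (suc zero))
      shearConj-zero12-diagonal = sym (begin
        (α + b) + (a + d)                ≈⟨ solve 4 (λ α a b d → (α :+ b) :+ (a :+ d)
                                              := ((α :+ o) :+ (o :+ d)) :+ (a :+ b)) refl α a b d ⟩
        ((α + 0#) + (0# + d)) + (a + b)  ≈⟨ +-congˡ a₀₁+a₁₀≈0 ⟩
        ((α + 0#) + (0# + d)) + 0#       ≈⟨ +-identityʳ _ ⟩
        (α + 0#) + (0# + d)              ∎)
        where
        α a b d : Carrier
        α = A zero zero
        a = A zero (suc zero)
        b = A (suc zero) zero
        d = A (suc zero) (suc zero)
        o : Polynomial 4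
        o = con (+ 0)

      charMat-shearConj-zero12 : ∀ i j →
        charMat (shearConj (zero12 R A)) u i j
          ≈ withCorner (charMat (shearConj A) u)
              (u * 0# - (A zero zero + 0#)) (u * 0# - (A zero zero + 0#)) i j
      charMat-shearConj-zero12 zero          zero          = refl
      charMat-shearConj-zero12 zero          (suc zero)    = refl
      charMat-shearConj-zero12 zero          (suc (suc j)) = refl
      charMat-shearConj-zero12 (suc zero)    zero          = refl
      charMat-shearConj-zero12 (suc zero)    (suc zero)    =
        -‿cong₂ refl shearConj-zero12-diagonal
      charMat-shearConj-zero12 (suc zero)    (suc (suc j)) = refl
      charMat-shearConj-zero12 (suc (suc i)) j             = refl

      charPoly-sub-conjB-zero12 :
        charPoly R (conjB R A) u - charPoly R (conjB R (zero12 R A)) u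
          ≈ shearedCornerOf (charMat A u)
              (u * 0# - (A zero zero + A zero (suc zero))) (u * 0# - (A zero zero + A (suc zero) zero))
            - shearedCornerOf (charMat A u)
                (u * 0# - (A zero zero + 0#)) (u * 0# - (A zero zero + 0#))
      charPoly-sub-conjB-zero12 = begin
        charPoly R (conjB R A) u - charPoly R (conjB R (zero12 R A)) u
          ≈⟨ -‿cong₂ (det-cong {M = charMat (conjB R A) u} charMat-conjB)
                     (det-cong {M = charMat (conjB R (zero12 R A)) u} charMat-conjB-zero12) ⟩
        det R Ñ - det R (withCorner Ñ p p)
          ≈⟨ det-sub-withCorner Ñ p p ⟩
        cornerOf Ñ (Ñ zero (suc zero)) (Ñ (suc zero) zero) - cornerOf Ñ p p
          ≈⟨ -‿cong₂ (cornerOf-shear charMat-shearConj _ _) (cornerOf-shear charMat-shearConj p p) ⟩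
        shearedCornerOf (charMat A u) (Ñ zero (suc zero)) (Ñ (suc zero) zero)
          - shearedCornerOf (charMat A u) p p ∎
        where
        Ñ : Matrix R (suc (suc m))
        Ñ = charMat (shearConj A) u
        p : Carrier
        p = u * 0# - (A zero zero + 0#)
        charMat-conjB : ∀ i j → charMat (conjB R A) u i j ≈ Ñ i j
        charMat-conjB i j = -‿cong₂ refl (conjB-shearConj A i j)
        charMat-conjB-zero12 : ∀ i j →
          charMat (conjB R (zero12 R A)) u i j ≈ withCorner Ñ p p i j
        charMat-conjB-zero12 i j =
          trans (-‿cong₂ refl (conjB-shearConj (zero12 R A) i j)) (charMat-shearConj-zero12 i j)

mainTheorem8 : {c ℓ : Level} (R : CommutativeRing c ℓ) (m : ℕ)
    (A : Matrix R (suc (suc m))) → IsAntisymmetric R A →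
    (u : CommutativeRing.Carrier R) →
    CommutativeRing._≈_ R
      (CommutativeRing._-_ R (charPoly R A u) (charPoly R (zero12 R A) u))
      (CommutativeRing._-_ R (charPoly R (conjB R A) u) (charPoly R (conjB R (zero12 R A)) u))
mainTheorem8 R m A anti u = begin
  charPoly R A u - charPoly R (zero12 R A) u
    ≈⟨ charPoly-sub-zero12 A u ⟩
  corner P V X (z - a) (z - b) - corner P V X (z - 0#) (z - 0#)
    ≈⟨ corner-shear-identity P V X Y z α a b ⟩
  sheared + (a + b) * (α * P + Y)
    ≈⟨ +-congˡ (trans (*-congʳ a+b≈0) (zeroˡ _)) ⟩
  sheared + 0#
    ≈⟨ +-identityʳ sheared ⟩
  sheared
    ≈⟨ charPoly-sub-conjB-zero12 A u a+b≈0 ⟨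
  charPoly R (conjB R A) u - charPoly R (conjB R (zero12 R A)) u ∎
  where
  open CommutativeRing R hiding (zero)
  open CornerExpansion R
  open import Relation.Binary.Reasoning.Setoid setoid
  P V X Y z α a b sheared : Carrier
  P = coeff₀₁₁₀ (charMat A u)
  V = coeff₀₁ (charMat A u)
  X = coeff₁₀ (charMat A u)
  Y = shearShift (charMat A u)
  z = u * 0#
  α = A zero zero
  a = A zero (suc zero)
  b = A (suc zero) zero
  sheared = corner P (Y + V) (X + Y) (z - (α + a)) (z - (α + b))
            - corner P (Y + V) (X + Y) (z - (α + 0#)) (z - (α + 0#))
  a+b≈0 : a + b ≈ 0#
  a+b≈0 = trans (+-congˡ (anti zero (suc zero))) (-‿inverseʳ a)
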